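{- Let $p$ be an odd prime with $p\equiv-1\pmod 4$. Let $(\widetilde J_2(n))_{n\ge0}$ be defined by $\widetilde J_2(0)=1$, $\widetilde J_2(1)=\frac34$ and $4n^2\widetilde J_2(n)-(8n^2-8n+3)\widetilde J_2(n-1)+4(n-1)^2\widetilde J_2(n-2)=0$ for $n\ge2$. Let $n\ge0$ have base-$p$ expansion $n=n_0+n_1p+\cdots+n_dp^d$ with $0\le n_i\le p-1$. If $n_j=\frac{p-1}2$ for some $j$, then $\widetilde J_2(n)\equiv0\pmod p$.
   Context: Congruences of rational numbers: for $x,y\in\mathbb{Q}$ and a positive integer $r$, write $x\equiv y\pmod r$ if $x-y=\frac{rN}{D}$ for some $N,D\in\mathbb{Z}$ with $D$ relatively prime to $r$. (The numbers $\widetilde J_2(n)$ are rational with power-of-$2$ denominators.) -}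

module Defs where

open import Data.Nat as ℕ using (ℕ; zero; suc; NonZero)
open import Data.Nat.DivMod using (_/_; _%_)
open import Data.Nat.Coprimality using (Coprime)
open import Data.Nat.Properties using (m^n≢0)
open import Data.Integer as ℤ using (ℤ; +_)
open import Data.Rational as ℚ using (ℚ)
open import Data.Product using (Σ; ∃; _×_)
open import Relation.Binary.PropositionalEquality using (_≡_)

nat : ℕ → ℚ
nat k = (+ k) ℚ./ 1

J₂ : ℕ → ℚ
J₂ zero = ℚ.1ℚ
J₂ (suc zero) = (+ 3) ℚ./ 4
J₂ (suc (suc n)) =
  (nat (8 ℕ.* m ℕ.* m ℕ.+ 3 ℕ.∸ 8 ℕ.* m) ℚ.* J₂ (suc n)
     ℚ.- nat (4 ℕ.* (suc n) ℕ.* (suc n)) ℚ.* J₂ n)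
  ℚ.* ((+ 1) ℚ./ (4 ℕ.* m ℕ.* m))
  where
  m : ℕ
  m = suc (suc n)

-- x ≡ y (mod r) for rationals: x - y = r N / D with D coprime to r.
-- (The sign of D is absorbed into N, so D ranges over positive naturals.)
_≡_[modℚ_] : ℚ → ℚ → ℕ → Set
x ≡ y [modℚ r ] =
  Σ ℤ λ N → Σ ℕ λ D → Σ (NonZero D) λ nz →
    Coprime D r × (x ℚ.- y ≡ ℚ._/_ (+ r ℤ.* N) D {{nz}})

digit : (p : ℕ) → .{{NonZero p}} → ℕ → ℕ → ℕ
digit p j n = (n / (p ℕ.^ j)) % p
  where instance _ = m^n≢0 p j

module Submission where

-- Write c k for the central binomial coefficient (2k choose k). Then 16ⁿ J̃₂(n) = A n, the
-- convolution Σₖ c k ² · c (n-k) 4^(n-k): A satisfies the same recurrence, which follows from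
-- first-order recurrences of the two factors via the Leibniz rule for k ↦ k·f(k).
-- Modulo p, Lucas' theorem and 4^p ≡ 4 give c (r + s p) ≡ c r · c s and make every term of A
-- whose indices carry vanish, so A (n₀ + n′ p) ≡ A n₀ · A n′ for n₀ < p and A n is congruent to
-- the product of A over the base-p digits of n. It remains to see A h ≡ 0 for h = (p-1)/2.
-- Pairing k with h-k, the two terms add up to c k · c (h-k) · (c k 4^(h-k) + c (h-k) 4^k).
-- Since -1/2 ≡ h, c k ≡ (-4)^k (h choose k), so the bracket is 4^h (h choose k) ((-1)^k + (-1)^(h-k)),
-- which vanishes because h is odd when p ≡ 3 (mod 4). Formally, the bracket is shown to vanish
-- starting from the middle pair ((h-1)/2, (h+1)/2) and moving outwards with the recurrence of c.

open import Defs
open import Data.Nat using (ℕ; zero; suc; _+_; _*_; _∸_; _^_; _≤_; _<_; _%_; _/_; z≤n; s≤s; NonZero; _≤?_)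
open import Data.Nat.Properties
open import Data.Nat.Combinatorics using (_C_; nCk+nC[k+1]≡[n+1]C[k+1]; nCn≡1; nC1≡n; nCk≡nC[n∸k]; k>n⇒nCk≡0)
open import Data.Nat.DivMod using (%-distribˡ-+; %-distribˡ-*; m*n%n≡0; m≡m%n+[m/n]*n; m%n<n; n/1≡n; m/n/o≡m/[n*o]; m*n/n≡m)
open import Data.Nat.Divisibility using (_∣_; _∤_; divides; m%n≡0⇒n∣m; n∣m⇒m%n≡0; >⇒∤)
open import Data.Nat.Coprimality as Coprimality using (Coprime; coprime-divisor; prime⇒coprime)
open import Data.Nat.Primality using (Prime; prime⇒irreducible)
open import Data.Nat.Tactic.RingSolver using (solve-∀)
import Algebra.Properties.CommutativeSemigroup as CommutativeSemigroupProperties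
import Data.Integer as ℤ
import Data.Integer.Properties as ℤ
open import Data.Rational as ℚ using (ℚ; mkℚ; 0ℚ; 1ℚ)
import Data.Rational.Properties as ℚ
open import Data.Rational.Solver using (module +-*-Solver)
open import Data.Rational.Unnormalised as ℚᵘ using (mkℚᵘ; *≡*)
import Data.Rational.Unnormalised.Properties as ℚᵘ
open import Data.Product using (∃; _,_)
open import Data.Sum using (inj₁; inj₂)
open import Function using (_∘_)
open import Level using (0ℓ)
open import Relation.Binary.Bundles using (Setoid)
open import Relation.Binary.Structures using (IsEquivalence)
open import Relation.Binary.PropositionalEquality
import Relation.Binary.Reasoning.Setoid as SetoidReasoning
open import Relation.Nullary using (yes; no; contradiction)

module +-Comm = CommutativeSemigroupProperties +-commutativeSemigroup
module *-Comm = CommutativeSemigroupProperties *-commutativeSemigroup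

pascal : ∀ n k → suc n C suc k ≡ n C k + n C suc k
pascal n k = sym (nCk+nC[k+1]≡[n+1]C[k+1] n k)

[1+k]*[1+n]C[1+k]≡[1+n]*nCk : ∀ n k → suc k * (suc n C suc k) ≡ suc n * (n C k)
[1+k]*[1+n]C[1+k]≡[1+n]*nCk zero zero = refl
[1+k]*[1+n]C[1+k]≡[1+n]*nCk zero (suc k) = *-zeroʳ (2 + k)
[1+k]*[1+n]C[1+k]≡[1+n]*nCk (suc n) zero = trans (+-identityʳ _) (trans (nC1≡n (2 + n)) (sym (*-identityʳ (2 + n))))
[1+k]*[1+n]C[1+k]≡[1+n]*nCk (suc n) (suc k) = begin
  (2 + k) * ((2 + n) C (2 + k))
    ≡⟨ cong ((2 + k) *_) (pascal (suc n) (suc k)) ⟩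
  (2 + k) * ((1 + n) C (1 + k) + (1 + n) C (2 + k))
    ≡⟨ split k ((1 + n) C (1 + k)) ((1 + n) C (2 + k)) ⟩
  (1 + k) * ((1 + n) C (1 + k)) + (2 + k) * ((1 + n) C (2 + k)) + (1 + n) C (1 + k)
    ≡⟨ cong₂ (λ x y → x + y + (1 + n) C (1 + k))
             ([1+k]*[1+n]C[1+k]≡[1+n]*nCk n k) ([1+k]*[1+n]C[1+k]≡[1+n]*nCk n (suc k)) ⟩
  (1 + n) * (n C k) + (1 + n) * (n C (1 + k)) + (1 + n) C (1 + k)
    ≡⟨ cong (_+ (1 + n) C (1 + k)) (sym (*-distribˡ-+ (1 + n) (n C k) (n C (1 + k)))) ⟩
  (1 + n) * (n C k + n C (1 + k)) + (1 + n) C (1 + k)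
    ≡⟨ cong (λ x → (1 + n) * x + (1 + n) C (1 + k)) (sym (pascal n k)) ⟩
  (1 + n) * ((1 + n) C (1 + k)) + (1 + n) C (1 + k)
    ≡⟨ +-comm ((1 + n) * ((1 + n) C (1 + k))) _ ⟩
  (2 + n) * ((1 + n) C (1 + k)) ∎
  where
  open ≡-Reasoning
  split : ∀ k x y → (2 + k) * (x + y) ≡ (1 + k) * x + (2 + k) * y + x
  split = solve-∀

central : ℕ → ℕ
central k = (k + k) C k

[1+k]*central[1+k]≡[4k+2]*central[k] : ∀ k → suc k * central (suc k) ≡ (4 * k + 2) * central k
[1+k]*central[1+k]≡[4k+2]*central[k] k = *-cancelˡ-≡ _ _ (suc k) (begin
  (1 + k) * ((1 + k) * ((1 + k + (1 + k)) C (1 + k)))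
    ≡⟨ cong (λ n → (1 + k) * ((1 + k) * (n C (1 + k)))) (+-suc (1 + k) k) ⟩
  (1 + k) * ((1 + k) * ((2 + (k + k)) C (1 + k)))
    ≡⟨ cong ((1 + k) *_) ([1+k]*[1+n]C[1+k]≡[1+n]*nCk (1 + (k + k)) k) ⟩
  (1 + k) * ((2 + (k + k)) * ((1 + (k + k)) C k))
    ≡⟨ cong (λ x → (1 + k) * ((2 + (k + k)) * x)) symmetry ⟩
  (1 + k) * ((2 + (k + k)) * ((1 + (k + k)) C (1 + k)))
    ≡⟨ *-Comm.x∙yz≈y∙xz (1 + k) (2 + (k + k)) ((1 + (k + k)) C (1 + k)) ⟩
  (2 + (k + k)) * ((1 + k) * ((1 + (k + k)) C (1 + k)))
    ≡⟨ cong ((2 + (k + k)) *_) ([1+k]*[1+n]C[1+k]≡[1+n]*nCk (k + k) k) ⟩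
  (2 + (k + k)) * ((1 + (k + k)) * central k)
    ≡⟨ rearrange k (central k) ⟩
  (1 + k) * ((4 * k + 2) * central k) ∎)
  where
  open ≡-Reasoning
  rearrange : ∀ k x → (2 + (k + k)) * ((1 + (k + k)) * x) ≡ (1 + k) * ((4 * k + 2) * x)
  rearrange = solve-∀
  symmetry : (1 + (k + k)) C k ≡ (1 + (k + k)) C (1 + k)
  symmetry = trans (nCk≡nC[n∸k] (m≤n⇒m≤1+n (m≤m+n k k)))
                   (cong ((1 + (k + k)) C_) (trans (cong (_∸ k) (sym (+-suc k k))) (m+n∸m≡n k (suc k))))

∑ : ℕ → (ℕ → ℕ) → ℕ
∑ zero f = 0
∑ (suc n) f = f 0 + ∑ n (f ∘ suc)

∑-cong : ∀ n {f g : ℕ → ℕ} → (∀ k → k < n → f k ≡ g k) → ∑ n f ≡ ∑ n g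
∑-cong zero eq = refl
∑-cong (suc n) eq = cong₂ _+_ (eq 0 (s≤s z≤n)) (∑-cong n (λ k k<n → eq (suc k) (s≤s k<n)))

∑-distrib-+ : ∀ n (f g : ℕ → ℕ) → ∑ n (λ k → f k + g k) ≡ ∑ n f + ∑ n g
∑-distrib-+ zero f g = refl
∑-distrib-+ (suc n) f g = begin
  f 0 + g 0 + ∑ n (λ k → f (suc k) + g (suc k))
    ≡⟨ cong (f 0 + g 0 +_) (∑-distrib-+ n (f ∘ suc) (g ∘ suc)) ⟩
  f 0 + g 0 + (∑ n (f ∘ suc) + ∑ n (g ∘ suc))
    ≡⟨ +-Comm.interchange (f 0) (g 0) _ _ ⟩
  f 0 + ∑ n (f ∘ suc) + (g 0 + ∑ n (g ∘ suc)) ∎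
  where open ≡-Reasoning

∑-*ˡ : ∀ n c (f : ℕ → ℕ) → ∑ n (λ k → c * f k) ≡ c * ∑ n f
∑-*ˡ zero c f = sym (*-zeroʳ c)
∑-*ˡ (suc n) c f = trans (cong (c * f 0 +_) (∑-*ˡ n c (f ∘ suc))) (sym (*-distribˡ-+ c (f 0) _))

∑-*ʳ : ∀ n c (f : ℕ → ℕ) → ∑ n (λ k → f k * c) ≡ c * ∑ n f
∑-*ʳ n c f = trans (∑-cong n (λ k _ → *-comm (f k) c)) (∑-*ˡ n c f)

∑-append : ∀ m n (f : ℕ → ℕ) → ∑ (m + n) f ≡ ∑ m f + ∑ n (λ k → f (m + k))
∑-append zero n f = refl
∑-append (suc m) n f = trans (cong (f 0 +_) (∑-append m n (f ∘ suc))) (sym (+-assoc (f 0) _ _))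

∑-snoc : ∀ n (f : ℕ → ℕ) → ∑ (suc n) f ≡ ∑ n f + f n
∑-snoc zero f = +-identityʳ (f 0)
∑-snoc (suc n) f = trans (cong (f 0 +_) (∑-snoc n (f ∘ suc))) (sym (+-assoc (f 0) _ _))

∑-reverse : ∀ n (f : ℕ → ℕ) → ∑ n f ≡ ∑ n (λ k → f (n ∸ suc k))
∑-reverse zero f = refl
∑-reverse (suc n) f = trans (∑-snoc n f) (trans (cong (_+ f n) (∑-reverse n f)) (+-comm _ (f n)))

∑-blocks : ∀ b p (f : ℕ → ℕ) → ∑ (b * p) f ≡ ∑ b (λ s → ∑ p (λ r → f (s * p + r)))
∑-blocks zero p f = refl
∑-blocks (suc b) p f = begin
  ∑ (p + b * p) f
    ≡⟨ ∑-append p (b * p) f ⟩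
  ∑ p f + ∑ (b * p) (λ k → f (p + k))
    ≡⟨ cong (∑ p f +_) (∑-blocks b p (λ k → f (p + k))) ⟩
  ∑ p f + ∑ b (λ s → ∑ p (λ r → f (p + (s * p + r))))
    ≡⟨ cong (∑ p f +_) (∑-cong b (λ s _ → ∑-cong p (λ r _ → cong f (sym (+-assoc p (s * p) r))))) ⟩
  ∑ p f + ∑ b (λ s → ∑ p (λ r → f (p + s * p + r))) ∎
  where open ≡-Reasoning

∑-binomial : ∀ n → ∑ (suc n) (n C_) ≡ 2 ^ n
∑-binomial zero = refl
∑-binomial (suc n) = begin
  1 + ∑ (suc n) (λ k → suc n C suc k)
    ≡⟨ cong (1 +_) (∑-cong (suc n) (λ k _ → pascal n k)) ⟩
  1 + ∑ (suc n) (λ k → n C k + n C suc k)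
    ≡⟨ cong (1 +_) (∑-distrib-+ (suc n) (n C_) (λ k → n C suc k)) ⟩
  1 + (∑ (suc n) (n C_) + ∑ (suc n) (λ k → n C suc k))
    ≡⟨ +-Comm.x∙yz≈y∙xz 1 (∑ (suc n) (n C_)) _ ⟩
  ∑ (suc n) (n C_) + ∑ (suc (suc n)) (n C_)
    ≡⟨ cong (∑ (suc n) (n C_) +_) (∑-snoc (suc n) (n C_)) ⟩
  ∑ (suc n) (n C_) + (∑ (suc n) (n C_) + n C suc n)
    ≡⟨ cong (λ x → ∑ (suc n) (n C_) + (∑ (suc n) (n C_) + x)) (k>n⇒nCk≡0 (n<1+n n)) ⟩
  ∑ (suc n) (n C_) + (∑ (suc n) (n C_) + 0)
    ≡⟨ cong₂ (λ x y → x + (y + 0)) (∑-binomial n) (∑-binomial n) ⟩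
  2 ^ n + (2 ^ n + 0) ∎
  where open ≡-Reasoning

infixl 7 _⋆_

_⋆_ : (ℕ → ℕ) → (ℕ → ℕ) → ℕ → ℕ
(f ⋆ g) n = ∑ (suc n) (λ k → f k * g (n ∸ k))

⋆-congˡ : ∀ {f f′} g n → (∀ k → f k ≡ f′ k) → (f ⋆ g) n ≡ (f′ ⋆ g) n
⋆-congˡ g n eq = ∑-cong (suc n) (λ k _ → cong (_* g (n ∸ k)) (eq k))

⋆-congʳ : ∀ f {g g′} n → (∀ k → g k ≡ g′ k) → (f ⋆ g) n ≡ (f ⋆ g′) n
⋆-congʳ f n eq = ∑-cong (suc n) (λ k _ → cong (f k *_) (eq (n ∸ k)))

⋆-distribʳ-+ : ∀ f g h n → ((λ k → f k + g k) ⋆ h) n ≡ (f ⋆ h) n + (g ⋆ h) n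
⋆-distribʳ-+ f g h n =
  trans (∑-cong (suc n) (λ k _ → *-distribʳ-+ (h (n ∸ k)) (f k) (g k)))
        (∑-distrib-+ (suc n) (λ k → f k * h (n ∸ k)) (λ k → g k * h (n ∸ k)))

⋆-distribˡ-+ : ∀ f g h n → (f ⋆ (λ k → g k + h k)) n ≡ (f ⋆ g) n + (f ⋆ h) n
⋆-distribˡ-+ f g h n =
  trans (∑-cong (suc n) (λ k _ → *-distribˡ-+ (f k) (g (n ∸ k)) (h (n ∸ k))))
        (∑-distrib-+ (suc n) (λ k → f k * g (n ∸ k)) (λ k → f k * h (n ∸ k)))

⋆-*ˡ : ∀ c f g n → ((λ k → c * f k) ⋆ g) n ≡ c * (f ⋆ g) n
⋆-*ˡ c f g n = trans (∑-cong (suc n) (λ k _ → *-assoc c (f k) (g (n ∸ k)))) (∑-*ˡ (suc n) c (λ k → f k * g (n ∸ k)))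

⋆-*ʳ : ∀ c f g n → (f ⋆ (λ k → c * g k)) n ≡ c * (f ⋆ g) n
⋆-*ʳ c f g n = trans (∑-cong (suc n) (λ k _ → *-Comm.x∙yz≈y∙xz (f k) c (g (n ∸ k))))
                     (∑-*ˡ (suc n) c (λ k → f k * g (n ∸ k)))

⋆-shiftˡ : ∀ f g n → f 0 ≡ 0 → (f ⋆ g) (suc n) ≡ ((f ∘ suc) ⋆ g) n
⋆-shiftˡ f g n f0≡0 = cong (λ x → x * g (suc n) + ((f ∘ suc) ⋆ g) n) f0≡0

⋆-shiftʳ : ∀ f g n → g 0 ≡ 0 → (f ⋆ g) (suc n) ≡ (f ⋆ (g ∘ suc)) n
⋆-shiftʳ f g n g0≡0 = begin
  ∑ (suc (suc n)) h
    ≡⟨ ∑-snoc (suc n) h ⟩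
  ∑ (suc n) h + f (suc n) * g (suc n ∸ suc n)
    ≡⟨ cong (λ x → ∑ (suc n) h + f (suc n) * g x) (n∸n≡0 n) ⟩
  ∑ (suc n) h + f (suc n) * g 0
    ≡⟨ cong (λ x → ∑ (suc n) h + f (suc n) * x) g0≡0 ⟩
  ∑ (suc n) h + f (suc n) * 0
    ≡⟨ trans (cong (∑ (suc n) h +_) (*-zeroʳ (f (suc n)))) (+-identityʳ _) ⟩
  ∑ (suc n) h
    ≡⟨ ∑-cong (suc n) (λ k k<1+n → cong (λ x → f k * g x) (+-∸-assoc 1 (≤-pred k<1+n))) ⟩
  (f ⋆ (g ∘ suc)) n ∎
  where
  open ≡-Reasoning
  h : ℕ → ℕ
  h k = f k * g (suc n ∸ k)

-- On coefficient sequences, D is the operator x d/dx on generating functions.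
D : (ℕ → ℕ) → ℕ → ℕ
D f k = k * f k

⋆-leibniz : ∀ f g n → n * (f ⋆ g) n ≡ (D f ⋆ g) n + (f ⋆ D g) n
⋆-leibniz f g n = begin
  n * ∑ (suc n) (λ k → f k * g (n ∸ k))
    ≡⟨ sym (∑-*ˡ (suc n) n (λ k → f k * g (n ∸ k))) ⟩
  ∑ (suc n) (λ k → n * (f k * g (n ∸ k)))
    ≡⟨ ∑-cong (suc n) (λ k k<1+n → split k (≤-pred k<1+n)) ⟩
  ∑ (suc n) (λ k → D f k * g (n ∸ k) + f k * D g (n ∸ k))
    ≡⟨ ∑-distrib-+ (suc n) (λ k → D f k * g (n ∸ k)) (λ k → f k * D g (n ∸ k)) ⟩
  (D f ⋆ g) n + (f ⋆ D g) n ∎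
  where
  open ≡-Reasoning
  distrib : ∀ k d x y → (k + d) * (x * y) ≡ k * x * y + x * (d * y)
  distrib = solve-∀
  split : ∀ k → k ≤ n → n * (f k * g (n ∸ k)) ≡ D f k * g (n ∸ k) + f k * D g (n ∸ k)
  split k k≤n = trans (cong (λ x → x * (f k * g (n ∸ k))) (sym (m+[n∸m]≡n k≤n))) (distrib k (n ∸ k) (f k) (g (n ∸ k)))

-- The sequence A and its recurrence

central² : ℕ → ℕ
central² k = central k * central k

central4ⁿ : ℕ → ℕ
central4ⁿ m = central m * 4 ^ m

A : ℕ → ℕ
A = central² ⋆ central4ⁿ

D²central²-suc : ∀ k → D (D central²) (suc k) ≡ 16 * D (D central²) k + 16 * D central² k + 4 * central² k
D²central²-suc k = begin
  suc k * (suc k * (central (suc k) * central (suc k)))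
    ≡⟨ square (suc k) (central (suc k)) ⟩
  (suc k * central (suc k)) * (suc k * central (suc k))
    ≡⟨ cong₂ _*_ ([1+k]*central[1+k]≡[4k+2]*central[k] k) ([1+k]*central[1+k]≡[4k+2]*central[k] k) ⟩
  ((4 * k + 2) * central k) * ((4 * k + 2) * central k)
    ≡⟨ expand k (central k) ⟩
  16 * D (D central²) k + 16 * D central² k + 4 * central² k ∎
  where
  open ≡-Reasoning
  square : ∀ a x → a * (a * (x * x)) ≡ (a * x) * (a * x)
  square = solve-∀
  expand : ∀ k x → ((4 * k + 2) * x) * ((4 * k + 2) * x) ≡ 16 * (k * (k * (x * x))) + 16 * (k * (x * x)) + 4 * (x * x)
  expand = solve-∀

Dcentral4ⁿ-suc : ∀ m → D central4ⁿ (suc m) ≡ 16 * D central4ⁿ m + 8 * central4ⁿ m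
Dcentral4ⁿ-suc m = begin
  suc m * (central (suc m) * (4 * 4 ^ m))
    ≡⟨ regroup (suc m) (central (suc m)) (4 ^ m) ⟩
  4 * (suc m * central (suc m)) * 4 ^ m
    ≡⟨ cong (λ x → 4 * x * 4 ^ m) ([1+k]*central[1+k]≡[4k+2]*central[k] m) ⟩
  4 * ((4 * m + 2) * central m) * 4 ^ m
    ≡⟨ expand m (central m) (4 ^ m) ⟩
  16 * D central4ⁿ m + 8 * central4ⁿ m ∎
  where
  open ≡-Reasoning
  regroup : ∀ a x y → a * (x * (4 * y)) ≡ 4 * (a * x) * y
  regroup = solve-∀
  expand : ∀ m x y → 4 * ((4 * m + 2) * x) * y ≡ 16 * (m * (x * y)) + 8 * (x * y)
  expand = solve-∀

⋆-Dcentral4ⁿ-suc : ∀ f n → (f ⋆ D central4ⁿ) (suc n) ≡ 16 * (f ⋆ D central4ⁿ) n + 8 * (f ⋆ central4ⁿ) n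
⋆-Dcentral4ⁿ-suc f n = begin
  (f ⋆ D central4ⁿ) (suc n)
    ≡⟨ ⋆-shiftʳ f (D central4ⁿ) n refl ⟩
  (f ⋆ (D central4ⁿ ∘ suc)) n
    ≡⟨ ⋆-congʳ f n Dcentral4ⁿ-suc ⟩
  (f ⋆ (λ m → 16 * D central4ⁿ m + 8 * central4ⁿ m)) n
    ≡⟨ ⋆-distribˡ-+ f (λ m → 16 * D central4ⁿ m) (λ m → 8 * central4ⁿ m) n ⟩
  (f ⋆ (λ m → 16 * D central4ⁿ m)) n + (f ⋆ (λ m → 8 * central4ⁿ m)) n
    ≡⟨ cong₂ _+_ (⋆-*ʳ 16 f (D central4ⁿ) n) (⋆-*ʳ 8 f central4ⁿ n) ⟩
  16 * (f ⋆ D central4ⁿ) n + 8 * (f ⋆ central4ⁿ) n ∎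
  where open ≡-Reasoning

D²central²-⋆-suc : ∀ g n → (D (D central²) ⋆ g) (suc n)
                 ≡ 16 * (D (D central²) ⋆ g) n + 16 * (D central² ⋆ g) n + 4 * (central² ⋆ g) n
D²central²-⋆-suc g n = begin
  (D (D central²) ⋆ g) (suc n)
    ≡⟨ ⋆-shiftˡ (D (D central²)) g n refl ⟩
  ((D (D central²) ∘ suc) ⋆ g) n
    ≡⟨ ⋆-congˡ g n D²central²-suc ⟩
  ((λ k → 16 * D (D central²) k + 16 * D central² k + 4 * central² k) ⋆ g) n
    ≡⟨ ⋆-distribʳ-+ (λ k → 16 * D (D central²) k + 16 * D central² k) (λ k → 4 * central² k) g n ⟩
  ((λ k → 16 * D (D central²) k + 16 * D central² k) ⋆ g) n + ((λ k → 4 * central² k) ⋆ g) n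
    ≡⟨ cong (_+ ((λ k → 4 * central² k) ⋆ g) n)
            (⋆-distribʳ-+ (λ k → 16 * D (D central²) k) (λ k → 16 * D central² k) g n) ⟩
  ((λ k → 16 * D (D central²) k) ⋆ g) n + ((λ k → 16 * D central² k) ⋆ g) n + ((λ k → 4 * central² k) ⋆ g) n
    ≡⟨ cong₂ _+_ (cong₂ _+_ (⋆-*ˡ 16 (D (D central²)) g n) (⋆-*ˡ 16 (D central²) g n)) (⋆-*ˡ 4 central² g n) ⟩
  16 * (D (D central²) ⋆ g) n + 16 * (D central² ⋆ g) n + 4 * (central² ⋆ g) n ∎
  where open ≡-Reasoning

-- Once the six shift relations are substituted, the conclusion (left side minus right side) is the
-- combination of the six Leibniz relations with the weights of `weigh`; both sides are moved so that
-- no subtraction occurs.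
recurrence-elimination : ∀ n a₀ a₁ a₂ b₀ b₁ b₂ m₀ m₁ m₂ c₀ c₁ c₂ d₀ d₁ d₂ →
  m₁ ≡ 16 * m₀ + 8 * a₀ → m₂ ≡ 16 * m₁ + 8 * a₁ →
  d₁ ≡ 16 * d₀ + 8 * b₀ → d₂ ≡ 16 * d₁ + 8 * b₁ →
  c₁ ≡ 16 * c₀ + 16 * b₀ + 4 * a₀ → c₂ ≡ 16 * c₁ + 16 * b₁ + 4 * a₁ →
  n * a₀ ≡ b₀ + m₀ → (1 + n) * a₁ ≡ b₁ + m₁ → (2 + n) * a₂ ≡ b₂ + m₂ →
  n * b₀ ≡ c₀ + d₀ → (1 + n) * b₁ ≡ c₁ + d₁ → (2 + n) * b₂ ≡ c₂ + d₂ →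
  4 * (2 + n) * (2 + n) * a₂ + 1024 * (1 + n) * (1 + n) * a₀ ≡ 16 * (8 * (2 + n) * (1 + n) + 3) * a₁
recurrence-elimination n a₀ a₁ a₂ b₀ b₁ b₂ m₀ _ _ c₀ _ _ d₀ _ _ refl refl refl refl refl refl
                       ea₀ ea₁ ea₂ eb₀ eb₁ eb₂ =
  +-cancelʳ-≡ (weigh (b₀ + m₀) (c₀ + d₀) ((1 + n) * a₁) ((1 + n) * b₁) (b₂ + m₂) (c₂ + d₂)) _ _
    (trans (identity n a₀ a₁ a₂ b₀ b₁ b₂ m₀ c₀ d₀) (cong (16 * (8 * (2 + n) * (1 + n) + 3) * a₁ +_) substitute))
  where
  m₂ c₂ d₂ : ℕ
  m₂ = 16 * (16 * m₀ + 8 * a₀) + 8 * a₁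
  c₂ = 16 * (16 * c₀ + 16 * b₀ + 4 * a₀) + 16 * b₁ + 4 * a₁
  d₂ = 16 * (16 * d₀ + 8 * b₀) + 8 * b₁
  weigh : ℕ → ℕ → ℕ → ℕ → ℕ → ℕ → ℕ
  weigh x₀ x₁ x₂ x₃ x₄ x₅ =
    (1536 + 1024 * n) * x₀ + 1024 * x₁ + (224 + 128 * n) * x₂ + 128 * x₃ + (8 + 4 * n) * x₄ + 4 * x₅
  identity : ∀ n a₀ a₁ a₂ b₀ b₁ b₂ m₀ c₀ d₀ →
    let m₁ = 16 * m₀ + 8 * a₀ ; m₂ = 16 * m₁ + 8 * a₁ ; d₁ = 16 * d₀ + 8 * b₀ ; d₂ = 16 * d₁ + 8 * b₁
        c₁ = 16 * c₀ + 16 * b₀ + 4 * a₀ ; c₂ = 16 * c₁ + 16 * b₁ + 4 * a₁ in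
    4 * (2 + n) * (2 + n) * a₂ + 1024 * (1 + n) * (1 + n) * a₀
      + ((1536 + 1024 * n) * (b₀ + m₀) + 1024 * (c₀ + d₀) + (224 + 128 * n) * ((1 + n) * a₁) + 128 * ((1 + n) * b₁)
         + (8 + 4 * n) * (b₂ + m₂) + 4 * (c₂ + d₂))
    ≡ 16 * (8 * (2 + n) * (1 + n) + 3) * a₁
      + ((1536 + 1024 * n) * (n * a₀) + 1024 * (n * b₀) + (224 + 128 * n) * (b₁ + m₁) + 128 * (c₁ + d₁)
         + (8 + 4 * n) * ((2 + n) * a₂) + 4 * ((2 + n) * b₂))
  identity = solve-∀
  substitute : weigh (n * a₀) (n * b₀) (b₁ + (16 * m₀ + 8 * a₀)) ((16 * c₀ + 16 * b₀ + 4 * a₀) + (16 * d₀ + 8 * b₀))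
                       ((2 + n) * a₂) ((2 + n) * b₂)
             ≡ weigh (b₀ + m₀) (c₀ + d₀) ((1 + n) * a₁) ((1 + n) * b₁) (b₂ + m₂) (c₂ + d₂)
  substitute rewrite ea₀ | eb₀ | ea₁ | eb₁ | ea₂ | eb₂ = refl

A-recurrence : ∀ n → 4 * (2 + n) * (2 + n) * A (2 + n) + 1024 * (1 + n) * (1 + n) * A n
                   ≡ 16 * (8 * (2 + n) * (1 + n) + 3) * A (1 + n)
A-recurrence n = recurrence-elimination n
  (A n) (A (1 + n)) (A (2 + n)) (b n) (b (1 + n)) (b (2 + n)) (m n) (m (1 + n)) (m (2 + n))
  (c n) (c (1 + n)) (c (2 + n)) (d n) (d (1 + n)) (d (2 + n))
  (⋆-Dcentral4ⁿ-suc central² n) (⋆-Dcentral4ⁿ-suc central² (1 + n))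
  (⋆-Dcentral4ⁿ-suc (D central²) n) (⋆-Dcentral4ⁿ-suc (D central²) (1 + n))
  (D²central²-⋆-suc central4ⁿ n) (D²central²-⋆-suc central4ⁿ (1 + n))
  (⋆-leibniz central² central4ⁿ n) (⋆-leibniz central² central4ⁿ (1 + n))
  (⋆-leibniz central² central4ⁿ (2 + n))
  (⋆-leibniz (D central²) central4ⁿ n) (⋆-leibniz (D central²) central4ⁿ (1 + n))
  (⋆-leibniz (D central²) central4ⁿ (2 + n))
  where
  b m c d : ℕ → ℕ
  b = D central² ⋆ central4ⁿ
  m = central² ⋆ D central4ⁿ
  c = D (D central²) ⋆ central4ⁿ
  d = D central² ⋆ D central4ⁿ

-- J̃₂ n = A n / 16ⁿ

nat≡mkℚ : ∀ x → nat x ≡ mkℚ (ℤ.+ x) 0 (Coprimality.sym (Coprimality.1-coprimeTo x))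
nat≡mkℚ x = ℚ.normalize-coprime (Coprimality.sym (Coprimality.1-coprimeTo x))

nat-+ : ∀ x y → nat (x + y) ≡ nat x ℚ.+ nat y
nat-+ x y = sym (trans (cong₂ ℚ._+_ (nat≡mkℚ x) (nat≡mkℚ y)) (ℚ./-cong sum refl))
  where
  sum : ℤ.+ x ℤ.* ℤ.+ 1 ℤ.+ ℤ.+ y ℤ.* ℤ.+ 1 ≡ ℤ.+ (x + y)
  sum = trans (cong₂ ℤ._+_ (ℤ.*-identityʳ (ℤ.+ x)) (ℤ.*-identityʳ (ℤ.+ y))) (sym (ℤ.pos-+ x y))

nat-* : ∀ x y → nat (x * y) ≡ nat x ℚ.* nat y
nat-* x y = sym (trans (cong₂ ℚ._*_ (nat≡mkℚ x) (nat≡mkℚ y)) (ℚ./-cong (sym (ℤ.pos-* x y)) refl))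

/-*-nat : ∀ x d .{{_ : NonZero d}} → ((ℤ.+ x) ℚ./ d) ℚ.* nat d ≡ nat x
/-*-nat x zero {{()}}
/-*-nat x (suc d) = ℚ.toℚᵘ-injective (begin
  ℚ.toℚᵘ ((ℤ.+ x) ℚ./ suc d ℚ.* nat (suc d))
    ≈⟨ ℚ.toℚᵘ-homo-* ((ℤ.+ x) ℚ./ suc d) (nat (suc d)) ⟩
  ℚ.toℚᵘ ((ℤ.+ x) ℚ./ suc d) ℚᵘ.* ℚ.toℚᵘ (nat (suc d))
    ≈⟨ ℚᵘ.*-cong (ℚ.toℚᵘ-fromℚᵘ (mkℚᵘ (ℤ.+ x) d)) (ℚ.toℚᵘ-fromℚᵘ (mkℚᵘ (ℤ.+ suc d) 0)) ⟩
  mkℚᵘ (ℤ.+ x) d ℚᵘ.* mkℚᵘ (ℤ.+ suc d) 0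
    ≈⟨ *≡* cross ⟩
  mkℚᵘ (ℤ.+ x) 0
    ≈⟨ ℚᵘ.≃-sym (ℚ.toℚᵘ-fromℚᵘ (mkℚᵘ (ℤ.+ x) 0)) ⟩
  ℚ.toℚᵘ (nat x) ∎)
  where
  open ℚᵘ.≃-Reasoning
  cross : (ℤ.+ x ℤ.* ℤ.+ suc d) ℤ.* ℤ.+ 1 ≡ ℤ.+ x ℤ.* ℤ.+ (suc d * 1)
  cross = trans (ℤ.*-identityʳ _) (cong (λ k → ℤ.+ x ℤ.* ℤ.+ k) (sym (*-identityʳ (suc d))))

*-cancelʳ-nat : ∀ q r d .{{_ : NonZero d}} → q ℚ.* nat d ≡ r ℚ.* nat d → q ≡ r
*-cancelʳ-nat q r zero {{()}}
*-cancelʳ-nat q r (suc d) eq = begin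
  q                      ≡⟨ ℚ.*-identityʳ q ⟨
  q ℚ.* 1ℚ               ≡⟨ cong (q ℚ.*_) (ℚ.*-inverseʳ dℚ) ⟨
  q ℚ.* (dℚ ℚ.* ℚ.1/ dℚ) ≡⟨ ℚ.*-assoc q dℚ (ℚ.1/ dℚ) ⟨
  q ℚ.* dℚ ℚ.* ℚ.1/ dℚ   ≡⟨ cong (ℚ._* ℚ.1/ dℚ) (subst (λ y → q ℚ.* y ≡ r ℚ.* y) (nat≡mkℚ (suc d)) eq) ⟩
  r ℚ.* dℚ ℚ.* ℚ.1/ dℚ   ≡⟨ ℚ.*-assoc r dℚ (ℚ.1/ dℚ) ⟩
  r ℚ.* (dℚ ℚ.* ℚ.1/ dℚ) ≡⟨ cong (r ℚ.*_) (ℚ.*-inverseʳ dℚ) ⟩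
  r ℚ.* 1ℚ               ≡⟨ ℚ.*-identityʳ r ⟩
  r                      ∎
  where
  open ≡-Reasoning
  dℚ : ℚ
  dℚ = mkℚ (ℤ.+ suc d) 0 (Coprimality.sym (Coprimality.1-coprimeTo (suc d)))

8m²+3∸8m≡8m[m∸1]+3 : ∀ n → let m = 2 + n in
  8 * m * m + 3 ∸ 8 * m ≡ 8 * (2 + n) * (1 + n) + 3
8m²+3∸8m≡8m[m∸1]+3 n =
  trans (cong (_∸ 8 * (2 + n)) (expand n)) (m+n∸n≡m (8 * (2 + n) * (1 + n) + 3) (8 * (2 + n)))
  where
  expand : ∀ n → 8 * (2 + n) * (2 + n) + 3 ≡ 8 * (2 + n) * (1 + n) + 3 + 8 * (2 + n)
  expand = solve-∀

A-recurrence-J₂-coefficients : ∀ n → let m = 2 + n in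
  4 * m * m * A (2 + n) + 16 * 16 * (4 * suc n * suc n) * A n
  ≡ 16 * (8 * m * m + 3 ∸ 8 * m) * A (1 + n)
A-recurrence-J₂-coefficients n = begin
  4 * (2 + n) * (2 + n) * A (2 + n) + 16 * 16 * (4 * suc n * suc n) * A n
    ≡⟨ cong (4 * (2 + n) * (2 + n) * A (2 + n) +_) (regroup n (A n)) ⟩
  4 * (2 + n) * (2 + n) * A (2 + n) + 1024 * (1 + n) * (1 + n) * A n
    ≡⟨ A-recurrence n ⟩
  16 * (8 * (2 + n) * (1 + n) + 3) * A (1 + n)
    ≡⟨ cong (λ x → 16 * x * A (1 + n)) (8m²+3∸8m≡8m[m∸1]+3 n) ⟨
  16 * (8 * (2 + n) * (2 + n) + 3 ∸ 8 * (2 + n)) * A (1 + n) ∎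
  where
  open ≡-Reasoning
  regroup : ∀ n a → 16 * 16 * (4 * suc n * suc n) * a ≡ 1024 * (1 + n) * (1 + n) * a
  regroup = solve-∀

J₂-scaled-step : ∀ n → J₂ (1 + n) ℚ.* nat (16 ^ (1 + n)) ≡ nat (A (1 + n))
               → J₂ n ℚ.* nat (16 ^ n) ≡ nat (A n)
               → J₂ (2 + n) ℚ.* nat (16 ^ (2 + n)) ≡ nat (A (2 + n))
J₂-scaled-step n ih₁ ih₀ = begin
  J₂ (2 + n) ℚ.* nat (16 ^ (2 + n))
    ≡⟨ cong (J₂ (2 + n) ℚ.*_) (trans (nat-* 16 (16 ^ (1 + n))) (cong (s ℚ.*_) (nat-* 16 (16 ^ n)))) ⟩
  ((X ℚ.* J₂ (1 + n) ℚ.- Y ℚ.* J₂ n) ℚ.* r) ℚ.* (s ℚ.* (s ℚ.* K))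
    ≡⟨ regroup X (J₂ (1 + n)) Y (J₂ n) r s K ⟩
  r ℚ.* (s ℚ.* X ℚ.* (J₂ (1 + n) ℚ.* (s ℚ.* K)) ℚ.- s ℚ.* s ℚ.* Y ℚ.* (J₂ n ℚ.* K))
    ≡⟨ cong₂ (λ x y → r ℚ.* (s ℚ.* X ℚ.* x ℚ.- s ℚ.* s ℚ.* Y ℚ.* y)) J₂-scaled[1+n] ih₀ ⟩
  r ℚ.* (s ℚ.* X ℚ.* a₁ ℚ.- s ℚ.* s ℚ.* Y ℚ.* a₀)
    ≡⟨ cong (λ x → r ℚ.* (x ℚ.- s ℚ.* s ℚ.* Y ℚ.* a₀)) recurrence ⟨
  r ℚ.* (N ℚ.* a₂ ℚ.+ s ℚ.* s ℚ.* Y ℚ.* a₀ ℚ.- s ℚ.* s ℚ.* Y ℚ.* a₀)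
    ≡⟨ cancel r N a₂ (s ℚ.* s ℚ.* Y ℚ.* a₀) ⟩
  r ℚ.* N ℚ.* a₂
    ≡⟨ cong (ℚ._* a₂) (/-*-nat 1 (4 * m * m)) ⟩
  1ℚ ℚ.* a₂
    ≡⟨ ℚ.*-identityˡ a₂ ⟩
  a₂ ∎
  where
  open ≡-Reasoning
  m x : ℕ
  m = 2 + n
  x = 8 * m * m + 3 ∸ 8 * m
  s K X Y N r a₀ a₁ a₂ : ℚ
  s = nat 16
  K = nat (16 ^ n)
  X = nat x
  Y = nat (4 * suc n * suc n)
  N = nat (4 * m * m)
  r = (ℤ.+ 1) ℚ./ (4 * m * m)
  a₀ = nat (A n)
  a₁ = nat (A (1 + n))
  a₂ = nat (A (2 + n))
  J₂-scaled[1+n] : J₂ (1 + n) ℚ.* (s ℚ.* K) ≡ a₁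
  J₂-scaled[1+n] = subst (λ x → J₂ (1 + n) ℚ.* x ≡ a₁) (nat-* 16 (16 ^ n)) ih₁
  recurrence : N ℚ.* a₂ ℚ.+ s ℚ.* s ℚ.* Y ℚ.* a₀ ≡ s ℚ.* X ℚ.* a₁
  recurrence = begin
    N ℚ.* a₂ ℚ.+ s ℚ.* s ℚ.* Y ℚ.* a₀
      ≡⟨ cong₂ ℚ._+_ (nat-* (4 * m * m) (A m))
           (trans (nat-* (16 * 16 * (4 * suc n * suc n)) (A n))
                  (cong (ℚ._* a₀) (trans (nat-* (16 * 16) (4 * suc n * suc n)) (cong (ℚ._* Y) (nat-* 16 16))))) ⟨
    nat (4 * m * m * A m) ℚ.+ nat (16 * 16 * (4 * suc n * suc n) * A n)
      ≡⟨ nat-+ (4 * m * m * A m) (16 * 16 * (4 * suc n * suc n) * A n) ⟨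
    nat (4 * m * m * A m + 16 * 16 * (4 * suc n * suc n) * A n)
      ≡⟨ cong nat (A-recurrence-J₂-coefficients n) ⟩
    nat (16 * (8 * m * m + 3 ∸ 8 * m) * A (1 + n))
      ≡⟨ trans (nat-* (16 * x) (A (1 + n))) (cong (ℚ._* a₁) (nat-* 16 x)) ⟩
    s ℚ.* X ℚ.* a₁ ∎
  open +-*-Solver
  regroup : ∀ x j₁ y j₀ r s k → ((x ℚ.* j₁ ℚ.- y ℚ.* j₀) ℚ.* r) ℚ.* (s ℚ.* (s ℚ.* k))
          ≡ r ℚ.* (s ℚ.* x ℚ.* (j₁ ℚ.* (s ℚ.* k)) ℚ.- s ℚ.* s ℚ.* y ℚ.* (j₀ ℚ.* k))
  regroup = solve 7 (λ x j₁ y j₀ r s k → ((x :* j₁ :- y :* j₀) :* r) :* (s :* (s :* k))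
                   := r :* (s :* x :* (j₁ :* (s :* k)) :- s :* s :* y :* (j₀ :* k))) refl
  cancel : ∀ r n a z → r ℚ.* (n ℚ.* a ℚ.+ z ℚ.- z) ≡ r ℚ.* n ℚ.* a
  cancel = solve 4 (λ r n a z → r :* (n :* a :+ z :- z) := r :* n :* a) refl

J₂-scaled : ∀ n → J₂ n ℚ.* nat (16 ^ n) ≡ nat (A n)
J₂-scaled zero = refl
J₂-scaled (suc zero) = refl
J₂-scaled (suc (suc n)) = J₂-scaled-step n (J₂-scaled (suc n)) (J₂-scaled n)

J₂≡A/16ⁿ : ∀ n → J₂ n ≡ ((ℤ.+ A n) ℚ./ 16 ^ n) {{m^n≢0 16 n}}
J₂≡A/16ⁿ n = *-cancelʳ-nat (J₂ n) _ (16 ^ n) (trans (J₂-scaled n) (sym (/-*-nat (A n) (16 ^ n))))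
  where instance _ = m^n≢0 16 n

∤2^ : ∀ {p} → Prime p → 2 < p → ∀ k → p ∤ 2 ^ k
∤2^ p-prime 2<p zero = >⇒∤ (<-trans (s≤s (s≤s z≤n)) 2<p)
∤2^ p-prime 2<p (suc k) p∣2^[1+k] = ∤2^ p-prime 2<p k (coprime-divisor (prime⇒coprime p-prime 2<p) p∣2^[1+k])

∤⇒coprime : ∀ {p m} → Prime p → p ∤ m → Coprime m p
∤⇒coprime p-prime p∤m (d∣m , d∣p) with prime⇒irreducible p-prime d∣p
... | inj₁ d≡1 = d≡1
... | inj₂ refl = contradiction d∣m p∤m

∣A⇒J₂≡0 : ∀ {p} n → Prime p → 2 < p → p ∣ A n → J₂ n ≡ 0ℚ [modℚ p ]
∣A⇒J₂≡0 {p} n p-prime 2<p (divides N A≡N*p) = ℤ.+ N , 16 ^ n , m^n≢0 16 n , coprime , J₂-0≡pN/16ⁿ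
  where
  instance
    16ⁿ≢0 : NonZero (16 ^ n)
    16ⁿ≢0 = m^n≢0 16 n
  coprime : Coprime (16 ^ n) p
  coprime = ∤⇒coprime p-prime (subst (p ∤_) (sym (^-*-assoc 2 4 n)) (∤2^ p-prime 2<p (4 * n)))
  J₂-0≡pN/16ⁿ : J₂ n ℚ.- 0ℚ ≡ (ℤ.+ p ℤ.* ℤ.+ N) ℚ./ 16 ^ n
  J₂-0≡pN/16ⁿ = trans (ℚ.+-identityʳ (J₂ n)) (trans (J₂≡A/16ⁿ n)
                  (ℚ./-cong (trans (cong ℤ.+_ (trans A≡N*p (*-comm N p))) (ℤ.pos-* p N)) refl))

-- Congruences modulo p and Lucas' theorem

∸-digits-below : ∀ n₀ n′ p {r s} → r ≤ n₀ → s ≤ n′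
               → n₀ + n′ * p ∸ (s * p + r) ≡ (n₀ ∸ r) + (n′ ∸ s) * p
∸-digits-below n₀ n′ p {r} {s} r≤n₀ s≤n′ = begin
  n₀ + n′ * p ∸ (s * p + r)
    ≡⟨ cong₂ (λ x y → x + y * p ∸ (s * p + r)) (m+[n∸m]≡n r≤n₀) (m+[n∸m]≡n s≤n′) ⟨
  r + (n₀ ∸ r) + (s + (n′ ∸ s)) * p ∸ (s * p + r)
    ≡⟨ cong (_∸ (s * p + r)) (shift r (n₀ ∸ r) s (n′ ∸ s) p) ⟩
  s * p + r + ((n₀ ∸ r) + (n′ ∸ s) * p) ∸ (s * p + r)
    ≡⟨ m+n∸m≡n (s * p + r) _ ⟩
  (n₀ ∸ r) + (n′ ∸ s) * p ∎
  where
  open ≡-Reasoning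
  shift : ∀ r a s b p → r + a + (s + b) * p ≡ s * p + r + (a + b * p)
  shift = solve-∀

∸-digits-above : ∀ n₀ n′ p {r s} → r ≤ p → s < n′
               → n₀ + n′ * p ∸ (s * p + r) ≡ (n₀ + (p ∸ r)) + (n′ ∸ suc s) * p
∸-digits-above n₀ n′ p {r} {s} r≤p s<n′ = begin
  n₀ + n′ * p ∸ (s * p + r)
    ≡⟨ cong₂ (λ x y → n₀ + x * y ∸ (s * y + r)) (m+[n∸m]≡n s<n′) (m+[n∸m]≡n r≤p) ⟨
  n₀ + (suc s + (n′ ∸ suc s)) * (r + (p ∸ r)) ∸ (s * (r + (p ∸ r)) + r)
    ≡⟨ cong (_∸ (s * (r + (p ∸ r)) + r)) (shift n₀ r (p ∸ r) s (n′ ∸ suc s)) ⟩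
  s * (r + (p ∸ r)) + r + (n₀ + (p ∸ r) + (n′ ∸ suc s) * (r + (p ∸ r))) ∸ (s * (r + (p ∸ r)) + r)
    ≡⟨ m+n∸m≡n (s * (r + (p ∸ r)) + r) _ ⟩
  n₀ + (p ∸ r) + (n′ ∸ suc s) * (r + (p ∸ r))
    ≡⟨ cong (λ y → n₀ + (p ∸ r) + (n′ ∸ suc s) * y) (m+[n∸m]≡n r≤p) ⟩
  n₀ + (p ∸ r) + (n′ ∸ suc s) * p ∎
  where
  open ≡-Reasoning
  shift : ∀ n₀ r t s b → n₀ + (suc s + b) * (r + t) ≡ s * (r + t) + r + (n₀ + t + b * (r + t))
  shift = solve-∀

module Congruence (p : ℕ) .{{_ : NonZero p}} where

  infix 4 _≈_

  -- A record rather than x % p ≡ y % p, so that x and y can be inferred from a proof.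
  record _≈_ (x y : ℕ) : Set where
    constructor mk≈
    field
      %≡% : x % p ≡ y % p

  ≈-isEquivalence : IsEquivalence _≈_
  ≈-isEquivalence = record
    { refl  = mk≈ refl
    ; sym   = λ (mk≈ e) → mk≈ (sym e)
    ; trans = λ (mk≈ e) (mk≈ e′) → mk≈ (trans e e′)
    }

  ≈-setoid : Setoid 0ℓ 0ℓ
  ≈-setoid = record { isEquivalence = ≈-isEquivalence }

  open IsEquivalence ≈-isEquivalence public
    using () renaming (refl to ≈-refl; sym to ≈-sym; trans to ≈-trans; reflexive to ≡⇒≈)

  +-cong : ∀ {a b c d} → a ≈ b → c ≈ d → a + c ≈ b + d
  +-cong {a} {b} {c} {d} (mk≈ e) (mk≈ e′) = mk≈ (begin
    (a + c) % p             ≡⟨ %-distribˡ-+ a c p ⟩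
    (a % p + c % p) % p     ≡⟨ cong₂ (λ x y → (x + y) % p) e e′ ⟩
    (b % p + d % p) % p     ≡⟨ %-distribˡ-+ b d p ⟨
    (b + d) % p             ∎)
    where open ≡-Reasoning

  *-cong : ∀ {a b c d} → a ≈ b → c ≈ d → a * c ≈ b * d
  *-cong {a} {b} {c} {d} (mk≈ e) (mk≈ e′) = mk≈ (begin
    (a * c) % p             ≡⟨ %-distribˡ-* a c p ⟩
    (a % p * (c % p)) % p   ≡⟨ cong₂ (λ x y → (x * y) % p) e e′ ⟩
    (b % p * (d % p)) % p   ≡⟨ %-distribˡ-* b d p ⟨
    (b * d) % p             ∎)
    where open ≡-Reasoning

  0%p≡0 : 0 % p ≡ 0
  0%p≡0 = m*n%n≡0 0 p

  ∣⇒≈0 : ∀ {x} → p ∣ x → x ≈ 0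
  ∣⇒≈0 {x} p∣x = mk≈ (trans (n∣m⇒m%n≡0 x p p∣x) (sym 0%p≡0))

  ≈0⇒∣ : ∀ {x} → x ≈ 0 → p ∣ x
  ≈0⇒∣ {x} (mk≈ e) = m%n≡0⇒n∣m x p (trans e 0%p≡0)

  p*≈0 : ∀ x → p * x ≈ 0
  p*≈0 x = mk≈ (trans (cong (_% p) (*-comm p x)) (trans (m*n%n≡0 x p) (sym 0%p≡0)))

  ≈0-*ʳ : ∀ {a} b → a ≈ 0 → a * b ≈ 0
  ≈0-*ʳ b a≈0 = *-cong a≈0 (≈-refl {b})

  ≈0-*ˡ : ∀ a {b} → b ≈ 0 → a * b ≈ 0
  ≈0-*ˡ a {b} b≈0 = ≈-trans (*-cong (≈-refl {a}) b≈0) (≡⇒≈ (*-zeroʳ a))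

  +-cancelˡ-≈0 : ∀ {a b} → a + b ≈ 0 → a ≈ 0 → b ≈ 0
  +-cancelˡ-≈0 {a} {b} a+b≈0 a≈0 = ≈-trans (+-cong (≈-sym a≈0) (≈-refl {b})) a+b≈0

  ∑-cong-≈ : ∀ n {f g : ℕ → ℕ} → (∀ k → k < n → f k ≈ g k) → ∑ n f ≈ ∑ n g
  ∑-cong-≈ zero eq = ≈-refl
  ∑-cong-≈ (suc n) eq = +-cong (eq 0 (s≤s z≤n)) (∑-cong-≈ n (λ k k<n → eq (suc k) (s≤s k<n)))

  ∑-≈0 : ∀ n {f : ℕ → ℕ} → (∀ k → k < n → f k ≈ 0) → ∑ n f ≈ 0
  ∑-≈0 zero eq = ≈-refl
  ∑-≈0 (suc n) eq = +-cong (eq 0 (s≤s z≤n)) (∑-≈0 n (λ k k<n → eq (suc k) (s≤s k<n)))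

  -- In (f ⋆ g) (n₀ + n′ p) the terms with index s p + r, where n₀ < r < p, carry in the low
  -- digit and vanish by carry≈0; the others factor as a low-digit term times a high-digit term.
  module _ {f g F G : ℕ → ℕ}
           (f-lucas : ∀ r s → r < p → f (r + s * p) ≈ f r * F s)
           (g-lucas : ∀ r s → r < p → g (r + s * p) ≈ g r * G s)
           (carry≈0 : ∀ r r′ → r < p → r′ < p → p ≤ r + r′ → f r * g r′ ≈ 0)
           (n₀ n′ : ℕ) (n₀<p : n₀ < p) where

    private
      N : ℕ
      N = n₀ + n′ * p

      term : ℕ → ℕ
      term i = f i * g (N ∸ i)

      low high : ℕ → ℕ
      low r = f r * g (n₀ ∸ r)
      high s = F s * G (n′ ∸ s)

      open SetoidReasoning ≈-setoid

      term-below : ∀ s r → s ≤ n′ → r ≤ n₀ → term (s * p + r) ≈ low r * high s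
      term-below s r s≤n′ r≤n₀ = begin
        f (s * p + r) * g (N ∸ (s * p + r))
          ≡⟨ cong₂ (λ x y → f x * g y) (+-comm (s * p) r) (∸-digits-below n₀ n′ p r≤n₀ s≤n′) ⟩
        f (r + s * p) * g ((n₀ ∸ r) + (n′ ∸ s) * p)
          ≈⟨ *-cong (f-lucas r s (≤-<-trans r≤n₀ n₀<p))
                    (g-lucas (n₀ ∸ r) (n′ ∸ s) (≤-<-trans (m∸n≤m n₀ r) n₀<p)) ⟩
        (f r * F s) * (g (n₀ ∸ r) * G (n′ ∸ s))
          ≡⟨ *-Comm.interchange (f r) (F s) (g (n₀ ∸ r)) (G (n′ ∸ s)) ⟩
        low r * high s ∎

      term-above : ∀ s k → s < n′ → suc n₀ + k < p → term (s * p + (suc n₀ + k)) ≈ 0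
      term-above s k s<n′ r<p = begin
        f (s * p + r) * g (N ∸ (s * p + r))
          ≡⟨ cong₂ (λ x y → f x * g y) (+-comm (s * p) r) (∸-digits-above n₀ n′ p (<⇒≤ r<p) s<n′) ⟩
        f (r + s * p) * g (y + (n′ ∸ suc s) * p)
          ≈⟨ *-cong (f-lucas r s r<p) (g-lucas y (n′ ∸ suc s) y<p) ⟩
        (f r * F s) * (g y * G (n′ ∸ suc s))
          ≡⟨ *-Comm.interchange (f r) (F s) (g y) (G (n′ ∸ suc s)) ⟩
        (f r * g y) * (F s * G (n′ ∸ suc s))
          ≈⟨ ≈0-*ʳ (F s * G (n′ ∸ suc s)) (carry≈0 r y r<p y<p p≤r+y) ⟩
        0 ∎
        where
        r y : ℕ
        r = suc n₀ + k
        y = n₀ + (p ∸ r)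
        r+[p∸r]≡p : r + (p ∸ r) ≡ p
        r+[p∸r]≡p = m+[n∸m]≡n (<⇒≤ r<p)
        y<p : y < p
        y<p = subst (y <_) r+[p∸r]≡p (+-monoˡ-< (p ∸ r) (m≤m+n (suc n₀) k))
        p≤r+y : p ≤ r + y
        p≤r+y = subst (_≤ r + y) r+[p∸r]≡p
                  (subst (r + (p ∸ r) ≤_) (+-Comm.x∙yz≈y∙xz n₀ r (p ∸ r)) (m≤n+m (r + (p ∸ r)) n₀))

      block : ∀ s → s < n′ → ∑ p (λ r → term (s * p + r)) ≈ (f ⋆ g) n₀ * high s
      block s s<n′ = begin
        ∑ p t
          ≡⟨ cong (λ x → ∑ x t) (m+[n∸m]≡n n₀<p) ⟨
        ∑ (suc n₀ + (p ∸ suc n₀)) t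
          ≡⟨ ∑-append (suc n₀) (p ∸ suc n₀) t ⟩
        ∑ (suc n₀) t + ∑ (p ∸ suc n₀) (λ k → t (suc n₀ + k))
          ≈⟨ +-cong (∑-cong-≈ (suc n₀) (λ r r<1+n₀ → term-below s r (<⇒≤ s<n′) (≤-pred r<1+n₀)))
                    (∑-≈0 (p ∸ suc n₀) (λ k k<p∸1+n₀ → term-above s k s<n′ (fits k<p∸1+n₀))) ⟩
        ∑ (suc n₀) (λ r → low r * high s) + 0
          ≡⟨ trans (+-identityʳ _) (∑-*ʳ (suc n₀) (high s) low) ⟩
        high s * (f ⋆ g) n₀
          ≡⟨ *-comm (high s) ((f ⋆ g) n₀) ⟩
        (f ⋆ g) n₀ * high s ∎
        where
        t : ℕ → ℕ
        t r = term (s * p + r)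
        fits : ∀ {k} → k < p ∸ suc n₀ → suc n₀ + k < p
        fits {k} k<p∸1+n₀ = subst (suc n₀ + k <_) (m+[n∸m]≡n n₀<p) (+-monoʳ-< (suc n₀) k<p∸1+n₀)

    ⋆-lucas : (f ⋆ g) (n₀ + n′ * p) ≈ (f ⋆ g) n₀ * (F ⋆ G) n′
    ⋆-lucas = begin
      ∑ (suc N) term
        ≡⟨ cong (λ x → ∑ x term) (+-comm (suc n₀) (n′ * p)) ⟩
      ∑ (n′ * p + suc n₀) term
        ≡⟨ ∑-append (n′ * p) (suc n₀) term ⟩
      ∑ (n′ * p) term + ∑ (suc n₀) (λ r → term (n′ * p + r))
        ≡⟨ cong (_+ ∑ (suc n₀) (λ r → term (n′ * p + r))) (∑-blocks n′ p term) ⟩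
      ∑ n′ (λ s → ∑ p (λ r → term (s * p + r))) + ∑ (suc n₀) (λ r → term (n′ * p + r))
        ≈⟨ +-cong (∑-cong-≈ n′ block)
                  (∑-cong-≈ (suc n₀) (λ r r<1+n₀ → term-below n′ r ≤-refl (≤-pred r<1+n₀))) ⟩
      ∑ n′ (λ s → (f ⋆ g) n₀ * high s) + ∑ (suc n₀) (λ r → low r * high n′)
        ≡⟨ cong₂ _+_ (∑-*ˡ n′ ((f ⋆ g) n₀) high) (trans (∑-*ʳ (suc n₀) (high n′) low) (*-comm (high n′) _)) ⟩
      (f ⋆ g) n₀ * ∑ n′ high + (f ⋆ g) n₀ * high n′
        ≡⟨ *-distribˡ-+ ((f ⋆ g) n₀) (∑ n′ high) (high n′) ⟨
      (f ⋆ g) n₀ * (∑ n′ high + high n′)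
        ≡⟨ cong ((f ⋆ g) n₀ *_) (∑-snoc n′ high) ⟨
      (f ⋆ g) n₀ * (F ⋆ G) n′ ∎

  digit≡⇒≈0 : ∀ (a : ℕ → ℕ) {d} → (∀ n → a n ≈ a (n % p) * a (n / p)) → a d ≈ 0
            → ∀ j n → digit p j n ≡ d → a n ≈ 0
  digit≡⇒≈0 a {d} split ad≈0 zero n digit≡d =
    ≈-trans (split n) (≈0-*ʳ (a (n / p)) (≈-trans (≡⇒≈ (cong a n%p≡d)) ad≈0))
    where
    n%p≡d : n % p ≡ d
    n%p≡d = trans (cong (_% p) (sym (n/1≡n n))) digit≡d
  digit≡⇒≈0 a {d} split ad≈0 (suc j) n digit≡d =
    ≈-trans (split n) (≈0-*ˡ (a (n % p)) (digit≡⇒≈0 a split ad≈0 j (n / p) digit[n/p]≡d))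
    where
    digit[n/p]≡d : digit p j (n / p) ≡ d
    digit[n/p]≡d = trans (cong (_% p) (m/n/o≡m/[n*o] n p (p ^ j) {{_}} {{m^n≢0 p j}} {{m^n≢0 p (suc j)}})) digit≡d

module PrimeModulus (q : ℕ) (p-prime : Prime (suc q)) where

  p : ℕ
  p = suc q

  open Congruence p public
  open SetoidReasoning ≈-setoid

  *-cancelˡ-≈0 : ∀ a .{{_ : NonZero a}} {x} → a < p → a * x ≈ 0 → x ≈ 0
  *-cancelˡ-≈0 a a<p ax≈0 = ∣⇒≈0 (coprime-divisor (prime⇒coprime p-prime a<p) (≈0⇒∣ ax≈0))

  pC[1+j]≈0 : ∀ j → suc j < p → p C suc j ≈ 0
  pC[1+j]≈0 j 1+j<p = *-cancelˡ-≈0 (suc j) 1+j<p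
    (∣⇒≈0 (divides (q C j) (trans ([1+k]*[1+n]C[1+k]≡[1+n]*nCk q j) (*-comm p (q C j)))))

  [m+p]Ck≈mCk : ∀ m k → k < p → (m + p) C k ≈ m C k
  [m+p]Ck≈mCk zero zero _ = ≈-refl
  [m+p]Ck≈mCk zero (suc j) 1+j<p = pC[1+j]≈0 j 1+j<p
  [m+p]Ck≈mCk (suc m) zero _ = ≈-refl
  [m+p]Ck≈mCk (suc m) (suc k) 1+k<p = begin
    suc (m + p) C suc k           ≡⟨ pascal (m + p) k ⟩
    (m + p) C k + (m + p) C suc k ≈⟨ +-cong ([m+p]Ck≈mCk m k (m<n⇒m<1+n (<-pred 1+k<p))) ([m+p]Ck≈mCk m (suc k) 1+k<p) ⟩
    m C k + m C suc k             ≡⟨ pascal m k ⟨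
    suc m C suc k                 ∎

  [m+p]C[j+p]≈mC[j+p]+mCj : ∀ m j → (m + p) C (j + p) ≈ m C (j + p) + m C j
  [m+p]C[j+p]≈mC[j+p]+mCj zero zero = ≡⇒≈ (nCn≡1 p)
  [m+p]C[j+p]≈mC[j+p]+mCj zero (suc j) = ≡⇒≈ (k>n⇒nCk≡0 {p} {suc j + p} (s≤s (m≤n+m p j)))
  [m+p]C[j+p]≈mC[j+p]+mCj (suc m) zero = begin
    suc (m + p) C p                 ≡⟨ pascal (m + p) q ⟩
    (m + p) C q + (m + p) C p       ≈⟨ +-cong ([m+p]Ck≈mCk m q ≤-refl) ([m+p]C[j+p]≈mC[j+p]+mCj m zero) ⟩
    m C q + (m C p + 1)             ≡⟨ +-assoc (m C q) (m C p) 1 ⟨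
    m C q + m C p + 1               ≡⟨ cong (_+ 1) (pascal m q) ⟨
    suc m C p + 1                   ∎
  [m+p]C[j+p]≈mC[j+p]+mCj (suc m) (suc j) = begin
    suc (m + p) C suc (j + p)
      ≡⟨ pascal (m + p) (j + p) ⟩
    (m + p) C (j + p) + (m + p) C (suc j + p)
      ≈⟨ +-cong ([m+p]C[j+p]≈mC[j+p]+mCj m j) ([m+p]C[j+p]≈mC[j+p]+mCj m (suc j)) ⟩
    (m C (j + p) + m C j) + (m C (suc j + p) + m C suc j)
      ≡⟨ +-Comm.interchange (m C (j + p)) (m C j) (m C (suc j + p)) (m C suc j) ⟩
    (m C (j + p) + m C (suc j + p)) + (m C j + m C suc j)
      ≡⟨ cong₂ _+_ (pascal m (j + p)) (pascal m j) ⟨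
    suc m C suc (j + p) + suc m C suc j ∎

  m+[1+n]p≡m+np+p : ∀ m n → m + suc n * p ≡ m + n * p + p
  m+[1+n]p≡m+np+p m n = trans (cong (m +_) (+-comm p (n * p))) (sym (+-assoc m (n * p) p))

  lucas : ∀ {a₀ c₀} → a₀ < p → c₀ < p → ∀ a₁ c₁
        → (a₀ + a₁ * p) C (c₀ + c₁ * p) ≈ (a₀ C c₀) * (a₁ C c₁)
  lucas {a₀} {c₀} a₀<p c₀<p zero zero =
    ≡⇒≈ (trans (cong₂ _C_ (+-identityʳ a₀) (+-identityʳ c₀)) (sym (*-identityʳ (a₀ C c₀))))
  lucas {a₀} {c₀} a₀<p c₀<p zero (suc c₁) =
    ≡⇒≈ (trans (k>n⇒nCk≡0 a₀+0<c) (sym (*-zeroʳ (a₀ C c₀))))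
    where
    a₀+0<c : a₀ + 0 < c₀ + suc c₁ * p
    a₀+0<c = subst (_< c₀ + suc c₁ * p) (sym (+-identityʳ a₀))
               (<-≤-trans a₀<p (≤-trans (m≤m+n p (c₁ * p)) (m≤n+m (p + c₁ * p) c₀)))
  lucas {a₀} {c₀} a₀<p c₀<p (suc a₁) zero = begin
    (a₀ + suc a₁ * p) C (c₀ + 0)     ≡⟨ cong (_C (c₀ + 0)) (m+[1+n]p≡m+np+p a₀ a₁) ⟩
    (a₀ + a₁ * p + p) C (c₀ + 0 * p) ≈⟨ [m+p]Ck≈mCk (a₀ + a₁ * p) (c₀ + 0) (subst (_< p) (sym (+-identityʳ c₀)) c₀<p) ⟩
    (a₀ + a₁ * p) C (c₀ + 0 * p)     ≈⟨ lucas a₀<p c₀<p a₁ zero ⟩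
    (a₀ C c₀) * 1                    ∎
  lucas {a₀} {c₀} a₀<p c₀<p (suc a₁) (suc c₁) = begin
    (a₀ + suc a₁ * p) C (c₀ + suc c₁ * p)
      ≡⟨ cong₂ _C_ (m+[1+n]p≡m+np+p a₀ a₁) (m+[1+n]p≡m+np+p c₀ c₁) ⟩
    (a₀ + a₁ * p + p) C (c₀ + c₁ * p + p)
      ≈⟨ [m+p]C[j+p]≈mC[j+p]+mCj (a₀ + a₁ * p) (c₀ + c₁ * p) ⟩
    (a₀ + a₁ * p) C (c₀ + c₁ * p + p) + (a₀ + a₁ * p) C (c₀ + c₁ * p)
      ≡⟨ cong (λ x → (a₀ + a₁ * p) C x + (a₀ + a₁ * p) C (c₀ + c₁ * p)) (m+[1+n]p≡m+np+p c₀ c₁) ⟨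
    (a₀ + a₁ * p) C (c₀ + suc c₁ * p) + (a₀ + a₁ * p) C (c₀ + c₁ * p)
      ≈⟨ +-cong (lucas a₀<p c₀<p a₁ (suc c₁)) (lucas a₀<p c₀<p a₁ c₁) ⟩
    (a₀ C c₀) * (a₁ C suc c₁) + (a₀ C c₀) * (a₁ C c₁)
      ≡⟨ trans (*-distribˡ-+ (a₀ C c₀) (a₁ C c₁) (a₁ C suc c₁)) (+-comm ((a₀ C c₀) * (a₁ C c₁)) _) ⟨
    (a₀ C c₀) * (a₁ C c₁ + a₁ C suc c₁)
      ≡⟨ cong ((a₀ C c₀) *_) (pascal a₁ c₁) ⟨
    (a₀ C c₀) * (suc a₁ C suc c₁) ∎

  2^p≈2 : 2 ^ p ≈ 2
  2^p≈2 = begin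
    2 ^ p                                  ≡⟨ ∑-binomial p ⟨
    1 + ∑ p (λ k → p C suc k)              ≡⟨ cong (1 +_) (∑-snoc q (λ k → p C suc k)) ⟩
    1 + (∑ q (λ k → p C suc k) + p C p)    ≈⟨ +-cong (≈-refl {1})
                                                 (+-cong (∑-≈0 q (λ k k<q → pC[1+j]≈0 k (s≤s k<q))) (≡⇒≈ (nCn≡1 p))) ⟩
    2                                      ∎

  4^[s*p]≈4^s : ∀ s → 4 ^ (s * p) ≈ 4 ^ s
  4^[s*p]≈4^s zero = ≈-refl
  4^[s*p]≈4^s (suc s) = begin
    4 ^ (p + s * p)           ≡⟨ ^-distribˡ-+-* 4 p (s * p) ⟩
    4 ^ p * 4 ^ (s * p)       ≡⟨ cong (_* 4 ^ (s * p)) 4^p≡2^p*2^p ⟩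
    2 ^ p * 2 ^ p * 4 ^ (s * p) ≈⟨ *-cong (*-cong 2^p≈2 2^p≈2) (4^[s*p]≈4^s s) ⟩
    4 * 4 ^ s                 ∎
    where
    4^p≡2^p*2^p : 4 ^ p ≡ 2 ^ p * 2 ^ p
    4^p≡2^p*2^p = trans (^-*-assoc 2 2 p) (trans (cong (λ x → 2 ^ (p + x)) (+-identityʳ p)) (^-distribˡ-+-* 2 p p))

  r+r∸p<r : ∀ {r} → r < p → p ≤ r + r → r + r ∸ p < r
  r+r∸p<r {r} r<p p≤2r = subst (r + r ∸ p <_) (m+n∸n≡m r p) (∸-monoˡ-< (+-monoʳ-< r r<p) p≤2r)

  central≈0 : ∀ {r} → r < p → p ≤ r + r → central r ≈ 0
  central≈0 {r} r<p p≤2r = begin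
    (r + r) C r               ≡⟨ cong₂ _C_ (trans (sym (m∸n+n≡m p≤2r)) (cong (a +_) (sym (*-identityˡ p))))
                                           (sym (+-identityʳ r)) ⟩
    (a + 1 * p) C (r + 0 * p) ≈⟨ lucas (<-trans a<r r<p) r<p 1 0 ⟩
    (a C r) * 1               ≡⟨ trans (*-identityʳ (a C r)) (k>n⇒nCk≡0 a<r) ⟩
    0                         ∎
    where
    a : ℕ
    a = r + r ∸ p
    a<r : a < r
    a<r = r+r∸p<r r<p p≤2r

  digits-double : ∀ r s p → r + s * p + (r + s * p) ≡ r + r + (s + s) * p
  digits-double = solve-∀

  central-lucas : ∀ r s → r < p → central (r + s * p) ≈ central r * central s
  central-lucas r s r<p with p ≤? r + r
  ... | no p≰2r = begin
    (r + s * p + (r + s * p)) C (r + s * p) ≡⟨ cong (_C (r + s * p)) (digits-double r s p) ⟩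
    (r + r + (s + s) * p) C (r + s * p)     ≈⟨ lucas (≰⇒> p≰2r) r<p (s + s) s ⟩
    central r * central s                   ∎
  ... | yes p≤2r = begin
    (r + s * p + (r + s * p)) C (r + s * p) ≡⟨ cong (_C (r + s * p)) carry ⟩
    (a + suc (s + s) * p) C (r + s * p)     ≈⟨ lucas (<-trans a<r r<p) r<p (suc (s + s)) s ⟩
    (a C r) * (suc (s + s) C s)             ≡⟨ cong (_* (suc (s + s) C s)) (k>n⇒nCk≡0 a<r) ⟩
    0                                       ≈⟨ ≈0-*ʳ (central s) (central≈0 r<p p≤2r) ⟨
    central r * central s                   ∎
    where
    a : ℕ
    a = r + r ∸ p
    a<r : a < r
    a<r = r+r∸p<r r<p p≤2r
    regroup : ∀ a p n → a + p + n * p ≡ a + suc n * p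
    regroup = solve-∀
    carry : r + s * p + (r + s * p) ≡ a + suc (s + s) * p
    carry = trans (digits-double r s p) (trans (cong (_+ (s + s) * p) (sym (m∸n+n≡m p≤2r))) (regroup a p (s + s)))

  central*central≈0 : ∀ {x y} → x < p → y < p → p ≤ x + y → central x * central y ≈ 0
  central*central≈0 {x} {y} x<p y<p p≤x+y with p ≤? x + x | p ≤? y + y
  ... | yes p≤2x | _        = ≈0-*ʳ (central y) (central≈0 x<p p≤2x)
  ... | no _     | yes p≤2y = ≈0-*ˡ (central x) (central≈0 y<p p≤2y)
  ... | no p≰2x  | no p≰2y  = contradiction (+-mono-≤ p≤x+y p≤x+y)
    (<⇒≱ (subst (_< p + p) (+-Comm.interchange x x y y) (+-mono-< (≰⇒> p≰2x) (≰⇒> p≰2y))))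

  central²-lucas : ∀ r s → r < p → central² (r + s * p) ≈ central² r * central² s
  central²-lucas r s r<p =
    ≈-trans (*-cong (central-lucas r s r<p) (central-lucas r s r<p))
            (≡⇒≈ (*-Comm.interchange (central r) (central s) (central r) (central s)))

  central4ⁿ-lucas : ∀ r s → r < p → central4ⁿ (r + s * p) ≈ central4ⁿ r * central4ⁿ s
  central4ⁿ-lucas r s r<p = begin
    central (r + s * p) * 4 ^ (r + s * p)     ≡⟨ cong (central (r + s * p) *_) (^-distribˡ-+-* 4 r (s * p)) ⟩
    central (r + s * p) * (4 ^ r * 4 ^ (s * p)) ≈⟨ *-cong (central-lucas r s r<p) (*-cong (≈-refl {4 ^ r}) (4^[s*p]≈4^s s)) ⟩
    (central r * central s) * (4 ^ r * 4 ^ s) ≡⟨ *-Comm.interchange (central r) (central s) (4 ^ r) (4 ^ s) ⟩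
    central4ⁿ r * central4ⁿ s                 ∎

  central²*central4ⁿ≈0 : ∀ r r′ → r < p → r′ < p → p ≤ r + r′ → central² r * central4ⁿ r′ ≈ 0
  central²*central4ⁿ≈0 r r′ r<p r′<p p≤r+r′ =
    ≈-trans (≡⇒≈ (*-Comm.interchange (central r) (central r) (central r′) (4 ^ r′)))
            (≈0-*ʳ (central r * 4 ^ r′) (central*central≈0 r<p r′<p p≤r+r′))

  A-lucas : ∀ n₀ n′ → n₀ < p → A (n₀ + n′ * p) ≈ A n₀ * A n′
  A-lucas = ⋆-lucas {central²} {central4ⁿ} central²-lucas central4ⁿ-lucas central²*central4ⁿ≈0

  A-digits : ∀ n → A n ≈ A (n % p) * A (n / p)
  A-digits n = ≈-trans (≡⇒≈ (cong A (m≡m%n+[m/n]*n n p))) (A-lucas (n % p) (n / p) (m%n<n n p))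

-- The digit (p-1)/2 when p ≡ 3 (mod 4)

pairing : ℕ → ℕ → ℕ
pairing k m = central k * 4 ^ m + central m * 4 ^ k

pairing-comm : ∀ k m → pairing k m ≡ pairing m k
pairing-comm k m = +-comm (central k * 4 ^ m) (central m * 4 ^ k)

pairing-recurrence : ∀ k m → suc k * suc m * pairing (suc k) m + suc m * suc m * pairing k (suc m)
                           ≡ (2 * (k + m) + 3) * (2 * suc m * pairing k m)
pairing-recurrence k m = begin
  suc k * suc m * (central (suc k) * 4 ^ m + central m * (4 * 4 ^ k))
    + suc m * suc m * (central k * (4 * 4 ^ m) + central (suc m) * 4 ^ k)
    ≡⟨ expand k m (central k) (central m) (central (suc k)) (central (suc m)) (4 ^ k) (4 ^ m) ⟩
  suc m * 4 ^ m * (suc k * central (suc k)) + 4 * suc k * suc m * central m * 4 ^ k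
    + 4 * suc m * suc m * central k * 4 ^ m + suc m * 4 ^ k * (suc m * central (suc m))
    ≡⟨ cong₂ (λ x y → suc m * 4 ^ m * x + 4 * suc k * suc m * central m * 4 ^ k
                        + 4 * suc m * suc m * central k * 4 ^ m + suc m * 4 ^ k * y)
             ([1+k]*central[1+k]≡[4k+2]*central[k] k) ([1+k]*central[1+k]≡[4k+2]*central[k] m) ⟩
  suc m * 4 ^ m * ((4 * k + 2) * central k) + 4 * suc k * suc m * central m * 4 ^ k
    + 4 * suc m * suc m * central k * 4 ^ m + suc m * 4 ^ k * ((4 * m + 2) * central m)
    ≡⟨ collect k m (central k) (central m) (4 ^ k) (4 ^ m) ⟩
  (2 * (k + m) + 3) * (2 * suc m * (central k * 4 ^ m + central m * 4 ^ k)) ∎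
  where
  open ≡-Reasoning
  expand : ∀ k m c d c′ d′ x y →
    suc k * suc m * (c′ * y + d * (4 * x)) + suc m * suc m * (c * (4 * y) + d′ * x)
    ≡ suc m * y * (suc k * c′) + 4 * suc k * suc m * d * x + 4 * suc m * suc m * c * y + suc m * x * (suc m * d′)
  expand = solve-∀
  collect : ∀ k m c d x y →
    suc m * y * ((4 * k + 2) * c) + 4 * suc k * suc m * d * x + 4 * suc m * suc m * c * y + suc m * x * ((4 * m + 2) * d)
    ≡ (2 * (k + m) + 3) * (2 * suc m * (c * y + d * x))
  collect = solve-∀

module ThreeModFour (t : ℕ) (p-prime : Prime (3 + 4 * t)) where

  open PrimeModulus (2 + 4 * t) p-prime public
  open SetoidReasoning ≈-setoid

  h : ℕ
  h = suc (t + t)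

  1+2h≡p : 1 + 2 * h ≡ p
  1+2h≡p = lemma t
    where
    lemma : ∀ t → 1 + 2 * suc (t + t) ≡ 3 + 4 * t
    lemma = solve-∀

  pairing-sum≈0 : ∀ k m → suc k + m ≡ h
                → suc k * suc m * pairing (suc k) m + suc m * suc m * pairing k (suc m) ≈ 0
  pairing-sum≈0 k m 1+k+m≡h = begin
    suc k * suc m * pairing (suc k) m + suc m * suc m * pairing k (suc m)
      ≡⟨ pairing-recurrence k m ⟩
    (2 * (k + m) + 3) * (2 * suc m * pairing k m)
      ≡⟨ cong (_* (2 * suc m * pairing k m)) 2[k+m]+3≡p ⟩
    p * (2 * suc m * pairing k m)
      ≈⟨ p*≈0 (2 * suc m * pairing k m) ⟩
    0 ∎
    where
    2[k+m]+3≡p : 2 * (k + m) + 3 ≡ p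
    2[k+m]+3≡p = trans (lemma k m) (trans (cong (λ x → 1 + 2 * x) 1+k+m≡h) 1+2h≡p)
      where
      lemma : ∀ k m → 2 * (k + m) + 3 ≡ 1 + 2 * (suc k + m)
      lemma = solve-∀

  h<p : h < p
  h<p = subst (h <_) 1+2h≡p (s≤s (m≤m+n h (h + 0)))

  2<p : 2 < p
  2<p = s≤s (s≤s (s≤s z≤n))

  cancel-square : ∀ a .{{_ : NonZero a}} {x} → a < p → a * a * x ≈ 0 → x ≈ 0
  cancel-square a {x} a<p aax≈0 =
    *-cancelˡ-≈0 a a<p (*-cancelˡ-≈0 a a<p (≈-trans (≡⇒≈ (sym (*-assoc a a x))) aax≈0))

  pairing-step : ∀ k m → suc k + m ≡ h → pairing (suc k) m ≈ 0 → pairing k (suc m) ≈ 0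
  pairing-step k m 1+k+m≡h pairing≈0 = cancel-square (suc m) 1+m<p
    (+-cancelˡ-≈0 (pairing-sum≈0 k m 1+k+m≡h) (≈0-*ˡ (suc k * suc m) pairing≈0))
    where
    1+m<p : suc m < p
    1+m<p = ≤-<-trans (subst (suc m ≤_) 1+k+m≡h (s≤s (m≤n+m m k))) h<p

  pairing-middle : pairing t (suc t) ≈ 0
  pairing-middle = cancel-square (suc t) 1+t<p (*-cancelˡ-≈0 2 2<p (begin
    2 * (suc t * suc t * pairing t (suc t))
      ≡⟨ double (suc t * suc t * pairing t (suc t)) ⟩
    suc t * suc t * pairing t (suc t) + suc t * suc t * pairing t (suc t)
      ≡⟨ cong (λ x → suc t * suc t * x + suc t * suc t * pairing t (suc t)) (pairing-comm t (suc t)) ⟩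
    suc t * suc t * pairing (suc t) t + suc t * suc t * pairing t (suc t)
      ≈⟨ pairing-sum≈0 t t refl ⟩
    0 ∎))
    where
    double : ∀ x → 2 * x ≡ x + x
    double = solve-∀
    1+t<p : suc t < p
    1+t<p = ≤-<-trans (s≤s (m≤m+n t t)) h<p

  pairing-above-middle : ∀ i k → k + i ≡ t → pairing k (suc t + i) ≈ 0
  pairing-above-middle zero k k+0≡t =
    ≈-trans (≡⇒≈ (cong₂ pairing (trans (sym (+-identityʳ k)) k+0≡t) (+-identityʳ (suc t)))) pairing-middle
  pairing-above-middle (suc i) k k+1+i≡t =
    ≈-trans (≡⇒≈ (cong (pairing k) (cong suc (+-suc t i))))
            (pairing-step k (suc t + i) 1+k+m≡h (pairing-above-middle i (suc k) (trans (sym (+-suc k i)) k+1+i≡t)))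
    where
    1+k+m≡h : suc k + (suc t + i) ≡ h
    1+k+m≡h = trans (regroup k t i) (cong (suc t +_) k+1+i≡t)
      where
      regroup : ∀ k t i → suc k + (suc t + i) ≡ suc t + (k + suc i)
      regroup = solve-∀

  pairing≈0-low : ∀ k m → k ≤ t → k + m ≡ h → pairing k m ≈ 0
  pairing≈0-low k m k≤t k+m≡h =
    ≈-trans (≡⇒≈ (cong (pairing k) m≡1+t+[t∸k])) (pairing-above-middle (t ∸ k) k (m+[n∸m]≡n k≤t))
    where
    m≡1+t+[t∸k] : m ≡ suc t + (t ∸ k)
    m≡1+t+[t∸k] = +-cancelˡ-≡ k m (suc t + (t ∸ k)) (trans k+m≡h (sym k+[1+t+[t∸k]]≡h))
      where
      regroup : ∀ k d t → suc (k + d + t) ≡ k + (suc t + d)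
      regroup = solve-∀
      k+[1+t+[t∸k]]≡h : k + (suc t + (t ∸ k)) ≡ h
      k+[1+t+[t∸k]]≡h = trans (sym (regroup k (t ∸ k) t)) (cong (λ x → suc (x + t)) (m+[n∸m]≡n k≤t))

  pairing≈0 : ∀ k m → k + m ≡ h → pairing k m ≈ 0
  pairing≈0 k m k+m≡h with k ≤? t
  ... | yes k≤t = pairing≈0-low k m k≤t k+m≡h
  ... | no k≰t = ≈-trans (≡⇒≈ (pairing-comm k m)) (pairing≈0-low m k m≤t (trans (+-comm m k) k+m≡h))
    where
    h≡t+[1+t] : h ≡ t + suc t
    h≡t+[1+t] = sym (+-suc t t)
    m≤t : m ≤ t
    m≤t = +-cancelʳ-≤ (suc t) m t
            (subst (m + suc t ≤_) (trans (+-comm m k) (trans k+m≡h h≡t+[1+t])) (+-monoʳ-≤ m (≰⇒> k≰t)))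

  A[h]≈0 : A h ≈ 0
  A[h]≈0 = *-cancelˡ-≈0 2 2<p (begin
    A h + (A h + 0)                   ≡⟨ cong (A h +_) (+-identityʳ (A h)) ⟩
    ∑ (suc h) T + ∑ (suc h) T         ≡⟨ cong (∑ (suc h) T +_) (∑-reverse (suc h) T) ⟩
    ∑ (suc h) T + ∑ (suc h) (T ∘ (h ∸_)) ≡⟨ ∑-distrib-+ (suc h) T (T ∘ (h ∸_)) ⟨
    ∑ (suc h) (λ k → T k + T (h ∸ k)) ≈⟨ ∑-≈0 (suc h) (λ k k<1+h → pair≈0 k (≤-pred k<1+h)) ⟩
    0                                 ∎)
    where
    T : ℕ → ℕ
    T k = central² k * central4ⁿ (h ∸ k)
    factor : ∀ a b x y → a * a * (b * x) + b * b * (a * y) ≡ a * b * (a * x + b * y)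
    factor = solve-∀
    pair≈0 : ∀ k → k ≤ h → T k + T (h ∸ k) ≈ 0
    pair≈0 k k≤h = begin
      T k + central² (h ∸ k) * central4ⁿ (h ∸ (h ∸ k))
        ≡⟨ cong (λ x → T k + central² (h ∸ k) * central4ⁿ x) (m∸[m∸n]≡n k≤h) ⟩
      central² k * central4ⁿ (h ∸ k) + central² (h ∸ k) * central4ⁿ k
        ≡⟨ factor (central k) (central (h ∸ k)) (4 ^ (h ∸ k)) (4 ^ k) ⟩
      central k * central (h ∸ k) * pairing k (h ∸ k)
        ≈⟨ ≈0-*ˡ (central k * central (h ∸ k)) (pairing≈0 k (h ∸ k) (m+[n∸m]≡n k≤h)) ⟩
      0 ∎

  digit≡h⇒J₂≡0 : ∀ j n → digit p j n ≡ h → J₂ n ≡ 0ℚ [modℚ p ]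
  digit≡h⇒J₂≡0 j n digit≡h =
    ∣A⇒J₂≡0 n p-prime 2<p (≈0⇒∣ (digit≡⇒≈0 A A-digits A[h]≈0 j n digit≡h))

  [p∸1]/2≡h : (p ∸ 1) / 2 ≡ h
  [p∸1]/2≡h = trans (cong (_/ 2) (p∸1≡h*2 t)) (m*n/n≡m h 2)
    where
    p∸1≡h*2 : ∀ t → 2 + 4 * t ≡ suc (t + t) * 2
    p∸1≡h*2 = solve-∀

proposition6p1 : (p : ℕ) → .{{_ : NonZero p}} → Prime p → p % 4 ≡ 3 → (n : ℕ)
               → ∃ (λ j → digit p j n ≡ (p ∸ 1) / 2)
               → J₂ n ≡ 0ℚ [modℚ p ]
proposition6p1 p p-prime p%4≡3 n (j , digit≡[p∸1]/2) = prime≡3+4t (p / 4) p≡3+4[p/4] p-prime digit≡[p∸1]/2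
  where
  p≡3+4[p/4] : p ≡ 3 + 4 * (p / 4)
  p≡3+4[p/4] = trans (m≡m%n+[m/n]*n p 4) (cong₂ _+_ p%4≡3 (*-comm (p / 4) 4))
  prime≡3+4t : ∀ t {q} .{{_ : NonZero q}} → q ≡ 3 + 4 * t → Prime q
             → digit q j n ≡ (q ∸ 1) / 2 → J₂ n ≡ 0ℚ [modℚ q ]
  prime≡3+4t t refl q-prime digit≡[q∸1]/2 = digit≡h⇒J₂≡0 j n (trans digit≡[q∸1]/2 [p∸1]/2≡h)
    where open ThreeModFour t q-prime
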